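{- For $2\le k\le n$, the number $z_{k,n}$ of $k$-element subsets $A\subseteq[n]$ for which the induced subgraph $P_n^2[A]$ is connected equals $$z_{k,n}=\sum_{j=0}^{\min\{k-1,n-k\}}\binom{k-1}{j}(n-k-j+1)=\sum_{j=0}^{k-1}\binom{k-1}{j}\max\{n-k-j+1,0\}.$$
   Context: The squared path $P_n^2$ is the graph on $[n]=\{1,\dots,n\}$ whose edges are the pairs $\{i,i+1\}$ ($1\le i\le n-1$) and $\{i,i+2\}$ ($1\le i\le n-2$). -}

module Defs where

open import Data.Nat using (ℕ; zero; suc; _+_; _*_; _∸_; _⊓_)
open import Data.Nat.Combinatorics using (_C_)
open import Data.Fin using (Fin; toℕ)
open import Data.Fin.Subset using (Subset; _∈_)
open import Data.List using (List; map; upTo)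
open import Data.Nat.ListAction using (sum)
open import Data.Sum using (_⊎_)
open import Relation.Binary.PropositionalEquality using (_≡_)

-- Vertex i : Fin n stands for the element (toℕ i + 1) of [n] = {1,…,n}.
-- Edges of the squared path P_n^2: {i,i+1} and {i,i+2}.
P²-Adj : ∀ {n} → Fin n → Fin n → Set
P²-Adj i j =
  (toℕ j ≡ toℕ i + 1) ⊎ (toℕ j ≡ toℕ i + 2) ⊎
  (toℕ i ≡ toℕ j + 1) ⊎ (toℕ i ≡ toℕ j + 2)

data Walk {n : ℕ} (A : Subset n) : Fin n → Fin n → Set where
  here : ∀ {i} → i ∈ A → Walk A i i
  step : ∀ {i j l} → i ∈ A → P²-Adj i j → Walk A j l → Walk A i l

InducedConnected : ∀ {n} → Subset n → Set
InducedConnected {n} A = ∀ (i j : Fin n) → i ∈ A → j ∈ A → Walk A i j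

sumUpTo : ℕ → (ℕ → ℕ) → ℕ
sumUpTo m f = sum (map f (upTo (suc m)))

-- Σ_{j=0}^{min{k-1,n-k}} C(k-1,j) (n-k-j+1)   (no truncation occurs since j ≤ n-k)
formula₁ : ℕ → ℕ → ℕ
formula₁ k n = sumUpTo ((k ∸ 1) ⊓ (n ∸ k)) (λ j → ((k ∸ 1) C j) * ((n ∸ k ∸ j) + 1))

-- Σ_{j=0}^{k-1} C(k-1,j) max{n-k-j+1,0};  max{n+1-(k+j),0} = (n+1) ∸ (k+j) in ℕ
formula₂ : ℕ → ℕ → ℕ
formula₂ k n = sumUpTo (k ∸ 1) (λ j → ((k ∸ 1) C j) * ((n + 1) ∸ (k + j)))

-- A set A ⊆ [n] induces a connected subgraph of P_n^2 exactly when consecutive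
-- elements of A differ by 1 or 2: edges have length at most 2, so two consecutive
-- missing vertices between elements of A separate it. Encoding such a k-set by its
-- least element and its k - 1 steps gives an explicit enumeration, from which
-- z_{k+1,n+2} = z_{k,n+1} + z_{k,n}, z_{1,n} = n and z_{k+1,0} = z_{k+1,1} = 0.
-- By Pascal's rule the binomial sum obeys the same recurrence; its two forms agree
-- because the terms with j > n - k vanish.
module Submission where

open import Defs
open import Data.Bool using (true; false)
open import Data.Empty using (⊥-elim)
open import Data.Fin using (Fin; zero; suc; toℕ)
open import Data.Fin.Subset using (Subset; ⊥; ∣_∣; _∈_; Nonempty)
open import Data.Fin.Subset.Properties using (nonempty?; Empty-unique; ∣⊥∣≡0; ∉⊥)
open import Data.List using (List; []; _∷_; [_]; _++_; _∷ʳ_; map; length; upTo)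
open import Data.List.Properties using (length-map; length-++; map-++; upTo-∷ʳ; map-upTo; map-applyUpTo)
open import Data.List.Membership.Propositional using () renaming (_∈_ to _∈ₗ_)
open import Data.List.Membership.Propositional.Properties using (∈-map⁺; ∈-map⁻; ∈-++⁺ˡ; ∈-++⁺ʳ; ∈-++⁻)
open import Data.List.Relation.Binary.Disjoint.Propositional using (Disjoint)
open import Data.List.Relation.Unary.All using ([])
open import Data.List.Relation.Unary.AllPairs using ([]; _∷_)
open import Data.List.Relation.Unary.Any using (here)
open import Data.List.Relation.Unary.Unique.Propositional using (Unique)
open import Data.List.Relation.Unary.Unique.Propositional.Properties using (map⁺; ++⁺)
open import Data.Nat using (ℕ; zero; suc; _+_; _*_; _∸_; _⊓_; _≤_; _<_; _≤′_; ≤′-refl; ≤′-step; z≤n; s≤s)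
open import Data.Nat.Combinatorics using (_C_; nCk+nC[k+1]≡[n+1]C[k+1]; k>n⇒nCk≡0)
open import Data.Nat.ListAction using (sum)
open import Data.Nat.ListAction.Properties using (sum-++)
open import Data.Nat.Properties
open import Algebra.Properties.CommutativeSemigroup +-commutativeSemigroup
  using (interchange)
open import Data.Product using (Σ; _×_; _,_; ∃-syntax)
open import Data.Sum using (_⊎_; inj₁; inj₂) renaming (map to ⊎-map)
open import Data.Vec using (Vec; []; _∷_; here; there)
open import Data.Vec.Properties using (∷-injectiveˡ; ∷-injectiveʳ)
open import Function using (_∘_)
open import Function.Bundles using (_⇔_; mk⇔)
import Function.Properties.Equivalence as ⇔
open import Relation.Binary.PropositionalEquality hiding ([_])
open import Relation.Nullary using (¬_; yes; no)

open ≡-Reasoning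

sum-map-+ : ∀ {A : Set} (f g : A → ℕ) xs →
  sum (map (λ x → f x + g x) xs) ≡ sum (map f xs) + sum (map g xs)
sum-map-+ f g [] = refl
sum-map-+ f g (x ∷ xs) =
  trans (cong (f x + g x +_) (sum-map-+ f g xs)) (interchange (f x) (g x) _ _)

sumUpTo-head : ∀ m f → sumUpTo (suc m) f ≡ f 0 + sumUpTo m (f ∘ suc)
sumUpTo-head m f = cong (λ xs → f 0 + sum xs)
  (trans (map-applyUpTo suc f (suc m)) (sym (map-upTo (f ∘ suc) (suc m))))

sumUpTo-last : ∀ m f → sumUpTo (suc m) f ≡ sumUpTo m f + f (suc m)
sumUpTo-last m f = begin
  sum (map f (upTo (suc (suc m))))             ≡⟨ cong (sum ∘ map f) (upTo-∷ʳ (suc m)) ⟨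
  sum (map f (upTo (suc m) ∷ʳ suc m))          ≡⟨ cong sum (map-++ f (upTo (suc m)) [ suc m ]) ⟩
  sum (map f (upTo (suc m)) ++ [ f (suc m) ])  ≡⟨ sum-++ (map f (upTo (suc m))) [ f (suc m) ] ⟩
  sumUpTo m f + (f (suc m) + 0)                ≡⟨ cong (sumUpTo m f +_) (+-identityʳ _) ⟩
  sumUpTo m f + f (suc m)                      ∎

sumUpTo-cong : ∀ m {f g} → (∀ j → j ≤ m → f j ≡ g j) → sumUpTo m f ≡ sumUpTo m g
sumUpTo-cong zero    eq = cong (_+ 0) (eq 0 z≤n)
sumUpTo-cong (suc m) {f} {g} eq = begin
  sumUpTo (suc m) f          ≡⟨ sumUpTo-head m f ⟩
  f 0 + sumUpTo m (f ∘ suc)  ≡⟨ cong₂ _+_ (eq 0 z≤n) (sumUpTo-cong m (λ j j≤m → eq (suc j) (s≤s j≤m))) ⟩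
  g 0 + sumUpTo m (g ∘ suc)  ≡⟨ sumUpTo-head m g ⟨
  sumUpTo (suc m) g          ∎

sumUpTo-extend : ∀ {m m'} f → m ≤ m' → (∀ j → m < j → j ≤ m' → f j ≡ 0) →
  sumUpTo m f ≡ sumUpTo m' f
sumUpTo-extend {m} f m≤m' = go (≤⇒≤′ m≤m')
  where
  go : ∀ {m'} → m ≤′ m' → (∀ j → m < j → j ≤ m' → f j ≡ 0) → sumUpTo m f ≡ sumUpTo m' f
  go ≤′-refl              vanish = refl
  go (≤′-step {n} m≤′n) vanish = begin
    sumUpTo m f              ≡⟨ go m≤′n (λ j m<j j≤n → vanish j m<j (m≤n⇒m≤1+n j≤n)) ⟩
    sumUpTo n f              ≡⟨ +-identityʳ _ ⟨
    sumUpTo n f + 0          ≡⟨ cong (sumUpTo n f +_) (vanish (suc n) (s≤s (≤′⇒≤ m≤′n)) ≤-refl) ⟨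
    sumUpTo n f + f (suc n)  ≡⟨ sumUpTo-last n f ⟨
    sumUpTo (suc n) f        ∎

sumUpTo-zero : ∀ m {f} → (∀ j → j ≤ m → f j ≡ 0) → sumUpTo m f ≡ 0
sumUpTo-zero m {f} vanish = begin
  sumUpTo m f  ≡⟨ sumUpTo-extend f z≤n (λ j _ j≤m → vanish j j≤m) ⟨
  f 0 + 0      ≡⟨ cong (_+ 0) (vanish 0 z≤n) ⟩
  0            ∎

binomialSum : ℕ → (ℕ → ℕ) → ℕ
binomialSum m g = sumUpTo m (λ j → (m C j) * g j)

binomialSum-suc : ∀ m g → binomialSum (suc m) g ≡ binomialSum m g + binomialSum m (g ∘ suc)
binomialSum-suc m g = begin
  binomialSum (suc m) g
    ≡⟨ sumUpTo-head m (λ j → (suc m C j) * g j) ⟩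
  head + sumUpTo m (λ j → (suc m C suc j) * g (suc j))
    ≡⟨ cong (head +_) (sumUpTo-cong m (λ j _ → pascal j)) ⟩
  head + sumUpTo m (λ j → upper j + (m C j) * g (suc j))
    ≡⟨ cong (head +_) (sum-map-+ upper (λ j → (m C j) * g (suc j)) (upTo (suc m))) ⟩
  head + (sumUpTo m upper + binomialSum m (g ∘ suc))
    ≡⟨ +-assoc head (sumUpTo m upper) (binomialSum m (g ∘ suc)) ⟨
  head + sumUpTo m upper + binomialSum m (g ∘ suc)
    ≡⟨ cong (_+ binomialSum m (g ∘ suc)) (sumUpTo-head m (λ j → (m C j) * g j)) ⟨
  sumUpTo (suc m) (λ j → (m C j) * g j) + binomialSum m (g ∘ suc)
    ≡⟨ cong (_+ binomialSum m (g ∘ suc)) (sumUpTo-last m (λ j → (m C j) * g j)) ⟩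
  binomialSum m g + (m C suc m) * g (suc m) + binomialSum m (g ∘ suc)
    ≡⟨ cong (λ c → binomialSum m g + c * g (suc m) + binomialSum m (g ∘ suc)) (k>n⇒nCk≡0 (n<1+n m)) ⟩
  binomialSum m g + 0 + binomialSum m (g ∘ suc)
    ≡⟨ cong (_+ binomialSum m (g ∘ suc)) (+-identityʳ (binomialSum m g)) ⟩
  binomialSum m g + binomialSum m (g ∘ suc)
    ∎
  where
  -- n C 0 reduces to 1, so this is the j = 0 term for both suc m and m.
  head : ℕ
  head = (m C 0) * g 0

  upper : ℕ → ℕ
  upper j = (m C suc j) * g (suc j)

  pascal : ∀ j → (suc m C suc j) * g (suc j) ≡ upper j + (m C j) * g (suc j)
  pascal j = begin
    (suc m C suc j) * g (suc j)                  ≡⟨ cong (_* g (suc j)) (nCk+nC[k+1]≡[n+1]C[k+1] m j) ⟨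
    (m C j + m C suc j) * g (suc j)              ≡⟨ cong (_* g (suc j)) (+-comm (m C j) _) ⟩
    (m C suc j + m C j) * g (suc j)              ≡⟨ *-distribʳ-+ (g (suc j)) (m C suc j) (m C j) ⟩
    (m C suc j) * g (suc j) + (m C j) * g (suc j) ∎

formula₂-one : ∀ n → formula₂ 1 n ≡ n
formula₂-one n = begin
  (n + 1) ∸ 1 + 0 + 0  ≡⟨ +-identityʳ _ ⟩
  (n + 1) ∸ 1 + 0      ≡⟨ +-identityʳ _ ⟩
  (n + 1) ∸ 1          ≡⟨ m+n∸n≡m n 1 ⟩
  n                    ∎

formula₂-< : ∀ {k n} → n < k → formula₂ k n ≡ 0
formula₂-< {suc k} {n} n<k = sumUpTo-zero k vanish
  where
  vanish : ∀ j → j ≤ k → (k C j) * ((n + 1) ∸ (suc k + j)) ≡ 0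
  vanish j _ = begin
    (k C j) * ((n + 1) ∸ (suc k + j))  ≡⟨ cong ((k C j) *_) (m≤n⇒m∸n≡0 n+1≤k+j) ⟩
    (k C j) * 0                        ≡⟨ *-zeroʳ (k C j) ⟩
    0                                  ∎
    where
    n+1≤k+j : n + 1 ≤ suc k + j
    n+1≤k+j = ≤-trans (≤-reflexive (+-comm n 1)) (≤-trans n<k (m≤m+n (suc k) j))

formula₂-recurrence : ∀ m n → formula₂ (2 + m) (2 + n) ≡ formula₂ (1 + m) (1 + n) + formula₂ (1 + m) n
formula₂-recurrence m n = begin
  formula₂ (2 + m) (2 + n)
    ≡⟨ binomialSum-suc m (λ j → (2 + n + 1) ∸ (2 + m + j)) ⟩
  formula₂ (1 + m) (1 + n) + binomialSum m (λ j → (n + 1) ∸ (m + suc j))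
    ≡⟨ cong (formula₂ (1 + m) (1 + n) +_) (sumUpTo-cong m (λ j _ → cong (λ t → (m C j) * ((n + 1) ∸ t)) (+-suc m j))) ⟩
  formula₂ (1 + m) (1 + n) + formula₂ (1 + m) n
    ∎

formula₁≡formula₂ : ∀ {k n} → k ≤ n → formula₁ k n ≡ formula₂ k n
formula₁≡formula₂ {zero} _ = refl
formula₁≡formula₂ {suc k} 1+k≤n with m≤n⇒∃[o]m+o≡n 1+k≤n
... | r , refl = begin
  formula₁ (suc k) (suc k + r)
    ≡⟨ cong (λ s → sumUpTo (k ⊓ s) (λ j → (k C j) * ((s ∸ j) + 1))) (m+n∸m≡n k r) ⟩
  sumUpTo (k ⊓ r) (λ j → (k C j) * ((r ∸ j) + 1))
    ≡⟨ sumUpTo-cong (k ⊓ r) (λ j j≤k⊓r → cong ((k C j) *_) (+-∸-comm 1 (≤-trans j≤k⊓r (m⊓n≤n k r)))) ⟨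
  sumUpTo (k ⊓ r) (λ j → (k C j) * ((r + 1) ∸ j))
    ≡⟨ sumUpTo-extend _ (m⊓n≤m k r) vanish ⟩
  sumUpTo k (λ j → (k C j) * ((r + 1) ∸ j))
    ≡⟨ sumUpTo-cong k (λ j _ → cong ((k C j) *_) (shift j)) ⟨
  formula₂ (suc k) (suc k + r)
    ∎
  where
  shift : ∀ j → (suc k + r + 1) ∸ (suc k + j) ≡ (r + 1) ∸ j
  shift j = trans (cong (_∸ (suc k + j)) (+-assoc (suc k) r 1)) ([m+n]∸[m+o]≡n∸o (suc k) (r + 1) j)
  vanish : ∀ j → k ⊓ r < j → j ≤ k → (k C j) * ((r + 1) ∸ j) ≡ 0
  vanish j k⊓r<j j≤k = begin
    (k C j) * ((r + 1) ∸ j)  ≡⟨ cong ((k C j) *_) (m≤n⇒m∸n≡0 (subst (_≤ j) (+-comm 1 r) r<j)) ⟩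
    (k C j) * 0              ≡⟨ *-zeroʳ (k C j) ⟩
    0                        ∎
    where
    r<j : r < j
    r<j = ≰⇒> (λ j≤r → <⇒≱ k⊓r<j (⊓-glb j≤k j≤r))

-- Hops m v: starting just before position 0, the members of v are reached by
-- m hops of length 1 or 2, and v has no members after the last one.
data Hops : ∀ {n} → ℕ → Subset n → Set where
  stop : ∀ {n} → Hops 0 (⊥ {n})
  hop₁ : ∀ {n m} {v : Subset n} → Hops m v → Hops (suc m) (true ∷ v)
  hop₂ : ∀ {n m} {v : Subset n} → Hops m v → Hops (suc m) (false ∷ true ∷ v)

data Block (m : ℕ) : ∀ {n} → Subset n → Set where
  skip  : ∀ {n} {v : Subset n} → Block m v → Block m (false ∷ v)
  start : ∀ {n} {v : Subset n} → Hops m v → Block m (true ∷ v)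

Hops-size : ∀ {m n} {v : Subset n} → Hops m v → ∣ v ∣ ≡ m
Hops-size {n = n} stop = ∣⊥∣≡0 n
Hops-size (hop₁ h) = cong suc (Hops-size h)
Hops-size (hop₂ h) = cong suc (Hops-size h)

Block-size : ∀ {m n} {v : Subset n} → Block m v → ∣ v ∣ ≡ suc m
Block-size (skip b)  = Block-size b
Block-size (start h) = cong suc (Hops-size h)

hops : (m n : ℕ) → List (Subset n)
hops zero    n             = [ ⊥ ]
hops (suc m) zero          = []
hops (suc m) (suc zero)    = map (true ∷_) (hops m 0)
hops (suc m) (suc (suc n)) = map (true ∷_) (hops m (suc n)) ++ map (false ∷_) (map (true ∷_) (hops m n))

blocks : (m n : ℕ) → List (Subset n)
blocks m zero    = []
blocks m (suc n) = map (false ∷_) (blocks m n) ++ map (true ∷_) (hops m n)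

∈-hops⁻ : ∀ m n {v} → v ∈ₗ hops m n → Hops m v
∈-hops⁻ zero    n             (here refl) = stop
∈-hops⁻ (suc m) (suc zero)    p with ∈-map⁻ (true ∷_) p
... | _ , q , refl = hop₁ (∈-hops⁻ m 0 q)
∈-hops⁻ (suc m) (suc (suc n)) p with ∈-++⁻ (map (true ∷_) (hops m (suc n))) p
... | inj₁ p₁ with ∈-map⁻ (true ∷_) p₁
...   | _ , q , refl = hop₁ (∈-hops⁻ m (suc n) q)
∈-hops⁻ (suc m) (suc (suc n)) p | inj₂ p₂ with ∈-map⁻ (false ∷_) p₂
...   | _ , p₃ , refl with ∈-map⁻ (true ∷_) p₃
...     | _ , q , refl = hop₂ (∈-hops⁻ m n q)

∈-hops⁺ : ∀ {m n} {v : Subset n} → Hops m v → v ∈ₗ hops m n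
∈-hops⁺ stop = here refl
∈-hops⁺ {n = suc zero}    (hop₁ h) = ∈-map⁺ (true ∷_) (∈-hops⁺ h)
∈-hops⁺ {n = suc (suc n)} (hop₁ h) = ∈-++⁺ˡ (∈-map⁺ (true ∷_) (∈-hops⁺ h))
∈-hops⁺ {suc m} {suc (suc n)} (hop₂ h) =
  ∈-++⁺ʳ (map (true ∷_) (hops m (suc n))) (∈-map⁺ (false ∷_) (∈-map⁺ (true ∷_) (∈-hops⁺ h)))

∈-blocks⇔ : ∀ {m n} {v : Subset n} → v ∈ₗ blocks m n ⇔ Block m v
∈-blocks⇔ = mk⇔ (∈-blocks⁻ _ _) ∈-blocks⁺
  where
  ∈-blocks⁻ : ∀ m n {v} → v ∈ₗ blocks m n → Block m v
  ∈-blocks⁻ m (suc n) p with ∈-++⁻ (map (false ∷_) (blocks m n)) p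
  ... | inj₁ p₁ with ∈-map⁻ (false ∷_) p₁
  ...   | _ , q , refl = skip (∈-blocks⁻ m n q)
  ∈-blocks⁻ m (suc n) p | inj₂ p₂ with ∈-map⁻ (true ∷_) p₂
  ...   | _ , q , refl = start (∈-hops⁻ m n q)

  ∈-blocks⁺ : ∀ {m n} {v : Subset n} → Block m v → v ∈ₗ blocks m n
  ∈-blocks⁺ (skip b) = ∈-++⁺ˡ (∈-map⁺ (false ∷_) (∈-blocks⁺ b))
  ∈-blocks⁺ {m} {suc n} (start h) = ∈-++⁺ʳ (map (false ∷_) (blocks m n)) (∈-map⁺ (true ∷_) (∈-hops⁺ h))

map-∷-disjoint : ∀ {A : Set} {n} {a b : A} {xs ys : List (Vec A n)} →
  a ≢ b → Disjoint (map (a ∷_) xs) (map (b ∷_) ys)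
map-∷-disjoint a≢b (p , q) with ∈-map⁻ _ p | ∈-map⁻ _ q
... | _ , _ , refl | _ , _ , eq = a≢b (∷-injectiveˡ eq)

hops-unique : ∀ m n → Unique (hops m n)
hops-unique zero    n             = [] ∷ []
hops-unique (suc m) zero          = []
hops-unique (suc m) (suc zero)    = map⁺ ∷-injectiveʳ (hops-unique m 0)
hops-unique (suc m) (suc (suc n)) =
  ++⁺ (map⁺ ∷-injectiveʳ (hops-unique m (suc n)))
      (map⁺ ∷-injectiveʳ (map⁺ ∷-injectiveʳ (hops-unique m n)))
      (map-∷-disjoint (λ ()))

blocks-unique : ∀ m n → Unique (blocks m n)
blocks-unique m zero    = []
blocks-unique m (suc n) =
  ++⁺ (map⁺ ∷-injectiveʳ (blocks-unique m n)) (map⁺ ∷-injectiveʳ (hops-unique m n)) (map-∷-disjoint (λ ()))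

length-blocks-suc : ∀ m n → length (blocks m (suc n)) ≡ length (blocks m n) + length (hops m n)
length-blocks-suc m n =
  trans (length-++ (map (false ∷_) (blocks m n)))
        (cong₂ _+_ (length-map _ (blocks m n)) (length-map _ (hops m n)))

length-hops-suc : ∀ m n → length (hops (suc m) (2 + n)) ≡ length (hops m (1 + n)) + length (hops m n)
length-hops-suc m n =
  trans (length-++ (map (true ∷_) (hops m (suc n))))
        (cong₂ _+_ (length-map _ (hops m (suc n)))
                   (trans (length-map (false ∷_) (map (true ∷_) (hops m n))) (length-map _ (hops m n))))

length-blocks-zero : ∀ n → length (blocks 0 n) ≡ n
length-blocks-zero zero    = refl
length-blocks-zero (suc n) = trans (length-blocks-suc 0 n) (trans (cong (_+ 1) (length-blocks-zero n)) (+-comm n 1))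

length-blocks-recurrence : ∀ m n →
  length (blocks (suc m) (2 + n)) ≡ length (blocks m (1 + n)) + length (blocks m n)
length-blocks-recurrence m zero = begin
  length (blocks (suc m) 2)       ≡⟨ length-blocks-suc (suc m) 1 ⟩
  length (hops (suc m) 1)         ≡⟨ length-map _ (hops m 0) ⟩
  length (hops m 0)               ≡⟨ length-blocks-suc m 0 ⟨
  length (blocks m 1)             ≡⟨ +-identityʳ _ ⟨
  length (blocks m 1) + 0         ∎
length-blocks-recurrence m (suc n) = begin
  length (blocks (suc m) (3 + n))
    ≡⟨ length-blocks-suc (suc m) (2 + n) ⟩
  length (blocks (suc m) (2 + n)) + length (hops (suc m) (2 + n))
    ≡⟨ cong₂ _+_ (length-blocks-recurrence m n) (length-hops-suc m n) ⟩
  (L (1 + n) + L n) + (T (1 + n) + T n)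
    ≡⟨ interchange (L (1 + n)) (L n) (T (1 + n)) (T n) ⟩
  (L (1 + n) + T (1 + n)) + (L n + T n)
    ≡⟨ cong₂ _+_ (length-blocks-suc m (1 + n)) (length-blocks-suc m n) ⟨
  L (2 + n) + L (1 + n)
    ∎
  where
  L T : ∀ n → ℕ
  L n = length (blocks m n)
  T n = length (hops m n)

length-blocks : ∀ m n → length (blocks m n) ≡ formula₂ (suc m) n
length-blocks zero    n             = trans (length-blocks-zero n) (sym (formula₂-one n))
length-blocks (suc m) zero          = sym (formula₂-< {2 + m} (s≤s z≤n))
length-blocks (suc m) (suc zero)    = sym (formula₂-< {2 + m} (s≤s (s≤s z≤n)))
length-blocks (suc m) (suc (suc n)) = begin
  length (blocks (suc m) (2 + n))                           ≡⟨ length-blocks-recurrence m n ⟩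
  length (blocks m (1 + n)) + length (blocks m n)           ≡⟨ cong₂ _+_ (length-blocks m (1 + n)) (length-blocks m n) ⟩
  formula₂ (1 + m) (1 + n) + formula₂ (1 + m) n             ≡⟨ formula₂-recurrence m n ⟨
  formula₂ (2 + m) (2 + n)                                  ∎

P²-Adj-sym : ∀ {n} {i j : Fin n} → P²-Adj i j → P²-Adj j i
P²-Adj-sym (inj₁ e)               = inj₂ (inj₂ (inj₁ e))
P²-Adj-sym (inj₂ (inj₁ e))        = inj₂ (inj₂ (inj₂ e))
P²-Adj-sym (inj₂ (inj₂ (inj₁ e))) = inj₁ e
P²-Adj-sym (inj₂ (inj₂ (inj₂ e))) = inj₂ (inj₁ e)

P²-Adj-suc : ∀ {n} {i j : Fin n} → P²-Adj i j → P²-Adj {suc n} (suc i) (suc j)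
P²-Adj-suc (inj₁ e)               = inj₁ (cong suc e)
P²-Adj-suc (inj₂ (inj₁ e))        = inj₂ (inj₁ (cong suc e))
P²-Adj-suc (inj₂ (inj₂ (inj₁ e))) = inj₂ (inj₂ (inj₁ (cong suc e)))
P²-Adj-suc (inj₂ (inj₂ (inj₂ e))) = inj₂ (inj₂ (inj₂ (cong suc e)))

P²-Adj-≤ : ∀ {n} {i j : Fin n} → P²-Adj i j → toℕ j ≤ toℕ i + 2
P²-Adj-≤ {i = i}     (inj₁ e)               = ≤-trans (≤-reflexive e) (+-monoʳ-≤ (toℕ i) (n≤1+n 1))
P²-Adj-≤             (inj₂ (inj₁ e))        = ≤-reflexive e
P²-Adj-≤ {i = i} {j} (inj₂ (inj₂ (inj₁ e))) =
  ≤-trans (≤-trans (m≤m+n (toℕ j) 1) (≤-reflexive (sym e))) (m≤m+n (toℕ i) 2)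
P²-Adj-≤ {i = i} {j} (inj₂ (inj₂ (inj₂ e))) =
  ≤-trans (≤-trans (m≤m+n (toℕ j) 2) (≤-reflexive (sym e))) (m≤m+n (toℕ i) 2)

module _ {n : ℕ} {A : Subset n} where

  walk-source∈ : ∀ {i j} → Walk A i j → i ∈ A
  walk-source∈ (here i∈A)     = i∈A
  walk-source∈ (step i∈A _ _) = i∈A

  walk-++ : ∀ {i j l} → Walk A i j → Walk A j l → Walk A i l
  walk-++ (here _)         w' = w'
  walk-++ (step i∈A adj w) w' = step i∈A adj (walk-++ w w')

  walk-reverse : ∀ {i j} → Walk A i j → Walk A j i
  walk-reverse w = go w (here (walk-source∈ w))
    where
    go : ∀ {i j l} → Walk A i j → Walk A i l → Walk A j l
    go (here _)       acc = acc
    go (step _ adj w) acc = go w (step (walk-source∈ w) (P²-Adj-sym adj) acc)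

  walk-suc : ∀ {x i j} → Walk A i j → Walk (x ∷ A) (suc i) (suc j)
  walk-suc (here i∈A)       = here (there i∈A)
  walk-suc (step i∈A adj w) = step (there i∈A) (P²-Adj-suc adj) (walk-suc w)

  -- Edges have length at most 2, so no walk jumps over the non-members c + 1 and c + 2.
  walk-stays-≤ : ∀ {c i j} → (∀ f → f ∈ A → toℕ f ≤ c ⊎ c + 3 ≤ toℕ f) →
    Walk A i j → toℕ i ≤ c → toℕ j ≤ c
  walk-stays-≤ sep (here _) i≤c = i≤c
  walk-stays-≤ {c} sep (step {j = k} _ adj w) i≤c with sep k (walk-source∈ w)
  ... | inj₁ k≤c   = walk-stays-≤ sep w k≤c
  ... | inj₂ c+3≤k = ⊥-elim (3≰2 (+-cancelˡ-≤ c 3 2 c+3≤c+2))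
    where
    c+3≤c+2 : c + 3 ≤ c + 2
    c+3≤c+2 = ≤-trans c+3≤k (≤-trans (P²-Adj-≤ adj) (+-monoˡ-≤ 2 i≤c))
    3≰2 : ¬ 3 ≤ 2
    3≰2 (s≤s (s≤s ()))

hops-reachable : ∀ {m n} {v : Subset n} {i} → Hops m v → i ∈ (true ∷ v) → Walk (true ∷ v) zero i
hops-reachable {i = zero}  _ _ = here here
hops-reachable {i = suc i} stop (there i∈⊥) = ⊥-elim (∉⊥ i∈⊥)
hops-reachable {i = suc i} (hop₁ h) (there i∈) = step here (inj₁ refl) (walk-suc (hops-reachable h i∈))
hops-reachable {i = suc zero}    (hop₂ h) (there ())
hops-reachable {i = suc (suc i)} (hop₂ h) (there (there i∈)) =
  step here (inj₂ (inj₁ refl)) (walk-suc (walk-suc (hops-reachable h i∈)))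

Block⇒connected : ∀ {m n} {v : Subset n} → Block m v → InducedConnected v
Block⇒connected (skip b) zero    _       ()         _
Block⇒connected (skip b) (suc i) zero    _          ()
Block⇒connected (skip b) (suc i) (suc j) (there i∈) (there j∈) = walk-suc (Block⇒connected b i j i∈ j∈)
Block⇒connected (start h) i j i∈ j∈ = walk-++ (walk-reverse (hops-reachable h i∈)) (hops-reachable h j∈)

record Gap {n} (v : Subset n) : Set where
  field
    cut       : ℕ
    separated : ∀ f → f ∈ v → toℕ f ≤ cut ⊎ cut + 3 ≤ toℕ f
    left      : Fin n
    right     : Fin n
    left∈     : left ∈ v
    right∈    : right ∈ v
    left≤cut  : toℕ left ≤ cut
    cut<right : cut < toℕ right

Gap⇒disconnected : ∀ {n} {v : Subset n} → Gap v → ¬ InducedConnected v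
Gap⇒disconnected g connected =
  <⇒≱ cut<right (walk-stays-≤ separated (connected left right left∈ right∈) left≤cut)
  where open Gap g

gap-suc : ∀ {n} {v : Subset n} {x} → Gap v → Gap (x ∷ v)
gap-suc g = record
  { cut = suc cut ; separated = separated′ ; left = suc left ; right = suc right
  ; left∈ = there left∈ ; right∈ = there right∈ ; left≤cut = s≤s left≤cut ; cut<right = s≤s cut<right }
  where
  open Gap g
  separated′ : ∀ f → f ∈ _ → toℕ f ≤ suc cut ⊎ suc cut + 3 ≤ toℕ f
  separated′ zero    _         = inj₁ z≤n
  separated′ (suc f) (there f∈) = ⊎-map s≤s s≤s (separated f f∈)

gap-start : ∀ {n} {w : Subset n} → Nonempty w → Gap (true ∷ false ∷ false ∷ w)
gap-start (q , q∈w) = record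
  { cut = 0 ; separated = separated ; left = zero ; right = suc (suc (suc q))
  ; left∈ = here ; right∈ = there (there (there q∈w)) ; left≤cut = z≤n ; cut<right = s≤s z≤n }
  where
  separated : ∀ f → f ∈ _ → toℕ f ≤ 0 ⊎ 3 ≤ toℕ f
  separated zero                _                   = inj₁ z≤n
  separated (suc zero)          (there ())
  separated (suc (suc zero))    (there (there ()))
  separated (suc (suc (suc f))) _                   = inj₂ (s≤s (s≤s (s≤s z≤n)))

hops-or-gap : ∀ {n} (v : Subset n) → (∃[ m ] Hops m v) ⊎ Gap (true ∷ v)
hops-or-gap [] = inj₁ (0 , stop)
hops-or-gap (true ∷ w) with hops-or-gap w
... | inj₁ (m , h) = inj₁ (suc m , hop₁ h)
... | inj₂ g       = inj₂ (gap-suc g)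
hops-or-gap (false ∷ []) = inj₁ (0 , stop)
hops-or-gap (false ∷ true ∷ w) with hops-or-gap w
... | inj₁ (m , h) = inj₁ (suc m , hop₂ h)
... | inj₂ g       = inj₂ (gap-suc (gap-suc g))
hops-or-gap (false ∷ false ∷ w) with nonempty? w
... | yes nonempty = inj₂ (gap-start nonempty)
... | no  empty rewrite Empty-unique empty = inj₁ (0 , stop)

block-or-gap : ∀ {n} (v : Subset n) → v ≡ ⊥ ⊎ (∃[ m ] Block m v) ⊎ Gap v
block-or-gap [] = inj₁ refl
block-or-gap (false ∷ w) with block-or-gap w
... | inj₁ refl            = inj₁ refl
... | inj₂ (inj₁ (m , b))  = inj₂ (inj₁ (m , skip b))
... | inj₂ (inj₂ g)        = inj₂ (inj₂ (gap-suc g))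
block-or-gap (true ∷ w) with hops-or-gap w
... | inj₁ (m , h) = inj₂ (inj₁ (m , start h))
... | inj₂ g       = inj₂ (inj₂ g)

connected⇒Block : ∀ {m n} {v : Subset n} → ∣ v ∣ ≡ suc m → InducedConnected v → Block m v
connected⇒Block {n = n} {v} size connected with block-or-gap v
... | inj₁ refl              = ⊥-elim (0≢1+n (trans (sym (∣⊥∣≡0 n)) size))
... | inj₂ (inj₂ g)          = ⊥-elim (Gap⇒disconnected g connected)
... | inj₂ (inj₁ (_ , b)) with suc-injective (trans (sym (Block-size b)) size)
...   | refl = b

Block⇔connected : ∀ {m n} {v : Subset n} → Block m v ⇔ (∣ v ∣ ≡ suc m × InducedConnected v)
Block⇔connected =
  mk⇔ (λ b → Block-size b , Block⇒connected b) (λ (size , connected) → connected⇒Block size connected)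

lemma3p2 : (k n : ℕ) → 2 ≤ k → k ≤ n →
    Σ (List (Subset n)) (λ L →
      Unique L ×
      ((A : Subset n) → (A ∈ₗ L) ⇔ ((∣ A ∣ ≡ k) × InducedConnected A)) ×
      (length L ≡ formula₁ k n) × (length L ≡ formula₂ k n))
lemma3p2 (suc m) n _ k≤n =
  blocks m n ,
  blocks-unique m n ,
  (λ A → ⇔.trans ∈-blocks⇔ Block⇔connected) ,
  trans (length-blocks m n) (sym (formula₁≡formula₂ k≤n)) ,
  length-blocks m n
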